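{- Let $k\ge 2$ and $n\ge 0$, and let $\pi=\pi_1\pi_2\cdots\pi_{(k+1)n}$ be a permutation of $\{1,\dots,(k+1)n\}$ that avoids the pattern $123$ and satisfies $\pi_{(k+1)i+1}<\pi_{(k+1)i+j}$ for all $0\le i<n$ and $2\le j\le k+1$ (i.e. $\pi=\pi_F$ for a $123$-avoiding $k$-ary shrub forest $F$). Then the root labels $\pi_1,\pi_{k+2},\pi_{2(k+1)+1},\dots,\pi_{(n-1)(k+1)+1}$ are decreasing from left to right, and the leaf labels (all the remaining entries of $\pi$, read from left to right) are also decreasing.
   Context: A permutation $\pi$ contains a pattern $\rho\in\mathcal{S}_m$ if some subsequence $\pi_{i_1}\cdots\pi_{i_m}$ ($i_1<\dots<i_m$) is order-isomorphic to $\rho$; otherwise it avoids $\rho$. A $k$-ary shrub is a rooted tree whose root has exactly $k$ children, all leaves. A $k$-ary shrub forest of $n$ shrubs is an ordered sequence of $n$ such shrubs whose $(k+1)n$ vertices are labeled bijectively by $\{1,\dots,(k+1)n\}$ so that each leaf has a larger label than its root; its associated permutation $\pi_F$ is obtained by reading, shrub by shrub from left to right, the root label followed by the leaf labels from left to right. $F$ avoids a pattern if $\pi_F$ does. In $\pi_F$, positions $(k+1)i+1$ hold the roots and all other positions hold leaves. -}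

module Defs where

open import Data.Nat using (ℕ; suc; _+_; _*_; _%_; _/_)
open import Data.Fin using (Fin; toℕ; _<_)
open import Data.Fin.Permutation using (Permutation; _⟨$⟩ʳ_)
open import Data.Product using (∃-syntax; _×_)
open import Relation.Nullary using (¬_)
open import Relation.Binary.PropositionalEquality using (_≡_)

-- A permutation of {1,…,N} is represented as a bijection of Fin N
-- (positions and values both shifted down by 1, which preserves order).

Contains123 : {N : ℕ} → Permutation N N → Set
Contains123 {N} π = ∃[ a ] ∃[ b ] ∃[ c ]
  (a < b × b < c × (π ⟨$⟩ʳ a) < (π ⟨$⟩ʳ b) × (π ⟨$⟩ʳ b) < (π ⟨$⟩ʳ c))

Avoids123 : {N : ℕ} → Permutation N N → Set
Avoids123 π = ¬ Contains123 π

-- 0-based position p (p = (k+1)i + (j-1) in 1-based terms) is a root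
-- position iff p ≡ 0 mod (k+1).
IsRootPos : (k : ℕ) {N : ℕ} → Fin N → Set
IsRootPos k p = toℕ p % suc k ≡ 0

IsLeafPos : (k : ℕ) {N : ℕ} → Fin N → Set
IsLeafPos k p = ¬ IsRootPos k p

ShrubCondition : (k n : ℕ) → Permutation (suc k * n) (suc k * n) → Set
ShrubCondition k n π =
  (p q : Fin (suc k * n)) → IsRootPos k p →
  ((j : ℕ) → 1 Data.Nat.≤ j → j Data.Nat.≤ k → toℕ q ≡ toℕ p + j →
    (π ⟨$⟩ʳ p) < (π ⟨$⟩ʳ q))

module Submission where

-- Two facts about an arbitrary 123-avoiding permutation π carry the proof.
-- If q is the bottom of an ascent (some later entry exceeds π q), then every
-- earlier entry exceeds π q; dually, if p is the top of an ascent (some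
-- earlier entry is below π p), then every later entry is below π p.
-- Otherwise the three entries would form a 123.
--
-- The shrub condition supplies the ascents: a root is the bottom of an
-- ascent, since its shrub has a first leaf right after it (this needs k ≥ 1
-- and the Euclidean-division bookkeeping below), and a leaf is the top of an
-- ascent, since its shrub root lies before it and has a smaller label.
-- Hence for roots p < q we get π q < π p from the first fact, and for
-- leaves p < q from the second.

open import Defs
open import Data.Nat using (ℕ; suc; _*_; _≤_; _+_; _%_; _/_; s≤s; z≤n; s≤s⁻¹)
  renaming (_<_ to _<ℕ_)
open import Data.Nat.Properties
  using (≤-trans; +-comm; *-comm; +-monoʳ-<; *-monoˡ-≤; n≢0⇒n>0;
         ≤-reflexive; ≤-<-trans; +-identityʳ; module ≤-Reasoning)
open import Data.Nat.DivMod using (m≡m%n+[m/n]*n; m<n*o⇒m/o<n; m/n*n≤m; m*n%n≡0; m%n<n)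
open import Data.Fin using (Fin; _<_; toℕ; fromℕ<)
open import Data.Fin.Properties using (<-cmp; toℕ<n; toℕ-fromℕ<; <⇒≢)
open import Data.Fin.Permutation using (Permutation; _⟨$⟩ʳ_; _⟨$⟩ˡ_; inverseˡ)
open import Data.Product using (∃-syntax; _×_; _,_)
open import Data.Empty using (⊥-elim)
open import Relation.Binary.Definitions using (tri<; tri≈; tri>)
open import Relation.Binary.PropositionalEquality using (_≡_; sym; trans; cong)

permute-injective : ∀ {N} (π : Permutation N N) {a b : Fin N} →
  π ⟨$⟩ʳ a ≡ π ⟨$⟩ʳ b → a ≡ b
permute-injective π {a} {b} e =
  trans (sym (inverseˡ π)) (trans (cong (π ⟨$⟩ˡ_) e) (inverseˡ π))

AscentFrom : ∀ {N} → Permutation N N → Fin N → Set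
AscentFrom π q = ∃[ c ] (q < c × (π ⟨$⟩ʳ q) < (π ⟨$⟩ʳ c))

AscentTo : ∀ {N} → Permutation N N → Fin N → Set
AscentTo π p = ∃[ r ] (r < p × (π ⟨$⟩ʳ r) < (π ⟨$⟩ʳ p))

earlier-above-ascent-bottom : ∀ {N} (π : Permutation N N) → Avoids123 π →
  {p q : Fin N} → AscentFrom π q → p < q → (π ⟨$⟩ʳ q) < (π ⟨$⟩ʳ p)
earlier-above-ascent-bottom π avoids {p} {q} (c , q<c , πq<πc) p<q
  with <-cmp (π ⟨$⟩ʳ q) (π ⟨$⟩ʳ p)
... | tri< πq<πp _ _ = πq<πp
... | tri≈ _ πq≡πp _ = ⊥-elim (<⇒≢ p<q (sym (permute-injective π πq≡πp)))
... | tri> _ _ πp<πq = ⊥-elim (avoids (p , q , c , p<q , q<c , πp<πq , πq<πc))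

later-below-ascent-top : ∀ {N} (π : Permutation N N) → Avoids123 π →
  {p q : Fin N} → AscentTo π p → p < q → (π ⟨$⟩ʳ q) < (π ⟨$⟩ʳ p)
later-below-ascent-top π avoids {p} {q} (r , r<p , πr<πp) p<q
  with <-cmp (π ⟨$⟩ʳ q) (π ⟨$⟩ʳ p)
... | tri< πq<πp _ _ = πq<πp
... | tri≈ _ πq≡πp _ = ⊥-elim (<⇒≢ p<q (sym (permute-injective π πq≡πp)))
... | tri> _ _ πp<πq = ⊥-elim (avoids (r , p , q , r<p , p<q , πr<πp , πp<πq))

root-has-successor : ∀ k n m → 1 ≤ k → m % suc k ≡ 0 → m <ℕ suc k * n →
  suc m <ℕ suc k * n
root-has-successor k n m k≥1 m%≡0 m<N = begin-strict
  suc m            ≡⟨ +-comm 1 m ⟩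
  m + 1            <⟨ +-monoʳ-< m (s≤s k≥1) ⟩
  m + suc k        ≡⟨ cong (_+ suc k) m≡d*[1+k] ⟩
  d * suc k + suc k ≡⟨ +-comm (d * suc k) (suc k) ⟩
  suc d * suc k    ≤⟨ *-monoˡ-≤ (suc k) d<n ⟩
  n * suc k        ≡⟨ *-comm n (suc k) ⟩
  suc k * n        ∎
  where
  open ≤-Reasoning
  d : ℕ
  d = m / suc k
  m≡d*[1+k] : m ≡ d * suc k
  m≡d*[1+k] = trans (m≡m%n+[m/n]*n m (suc k)) (cong (_+ d * suc k) m%≡0)
  d<n : d <ℕ n
  d<n = m<n*o⇒m/o<n (≤-trans m<N (≤-reflexive (*-comm (suc k) n)))

shrub-root : ∀ k {N} → Fin N → Fin N
shrub-root k p = fromℕ< (≤-<-trans (m/n*n≤m (toℕ p) (suc k)) (toℕ<n p))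

toℕ-shrub-root : ∀ k {N} (p : Fin N) → toℕ (shrub-root k p) ≡ toℕ p / suc k * suc k
toℕ-shrub-root k p = toℕ-fromℕ< (≤-<-trans (m/n*n≤m (toℕ p) (suc k)) (toℕ<n p))

shrub-root-offset : ∀ k {N} (p : Fin N) → toℕ p ≡ toℕ (shrub-root k p) + toℕ p % suc k
shrub-root-offset k p = trans (m≡m%n+[m/n]*n (toℕ p) (suc k))
  (trans (+-comm (toℕ p % suc k) _) (cong (_+ toℕ p % suc k) (sym (toℕ-shrub-root k p))))

shrub-root-isRoot : ∀ k {N} (p : Fin N) → IsRootPos k (shrub-root k p)
shrub-root-isRoot k p =
  trans (cong (_% suc k) (toℕ-shrub-root k p)) (m*n%n≡0 (toℕ p / suc k) (suc k))

root-is-ascent-bottom : ∀ k n (π : Permutation (suc k * n) (suc k * n)) → 1 ≤ k →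
  ShrubCondition k n π → (q : Fin (suc k * n)) → IsRootPos k q → AscentFrom π q
root-is-ascent-bottom k n π k≥1 shrub q q-root =
  leaf , q<leaf , shrub q leaf q-root 1 (s≤s z≤n) k≥1 leaf-offset
  where
  bound : suc (toℕ q) <ℕ suc k * n
  bound = root-has-successor k n (toℕ q) k≥1 q-root (toℕ<n q)
  leaf : Fin (suc k * n)
  leaf = fromℕ< bound
  leaf-offset : toℕ leaf ≡ toℕ q + 1
  leaf-offset = trans (toℕ-fromℕ< bound) (+-comm 1 (toℕ q))
  q<leaf : q < leaf
  q<leaf = ≤-reflexive (sym (toℕ-fromℕ< bound))

leaf-is-ascent-top : ∀ k n (π : Permutation (suc k * n) (suc k * n)) →
  ShrubCondition k n π → (p : Fin (suc k * n)) → IsLeafPos k p → AscentTo π p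
leaf-is-ascent-top k n π shrub p p-leaf = root , root<p ,
  shrub root p (shrub-root-isRoot k p) offset 1≤offset (s≤s⁻¹ (m%n<n (toℕ p) (suc k)))
    (shrub-root-offset k p)
  where
  root : Fin (suc k * n)
  root = shrub-root k p
  offset : ℕ
  offset = toℕ p % suc k
  1≤offset : 1 ≤ offset
  1≤offset = n≢0⇒n>0 p-leaf
  root<p : root < p
  root<p = begin-strict
    toℕ root          ≡⟨ sym (+-identityʳ (toℕ root)) ⟩
    toℕ root + 0      <⟨ +-monoʳ-< (toℕ root) 1≤offset ⟩
    toℕ root + offset ≡⟨ sym (shrub-root-offset k p) ⟩
    toℕ p             ∎
    where open ≤-Reasoning

lemma2 : (k n : ℕ) → 2 ≤ k → (π : Permutation (suc k * n) (suc k * n)) →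
    Avoids123 π → ShrubCondition k n π →
    ((p q : Fin (suc k * n)) → IsRootPos k p → IsRootPos k q → p < q →
      (π ⟨$⟩ʳ q) < (π ⟨$⟩ʳ p))
    × ((p q : Fin (suc k * n)) → IsLeafPos k p → IsLeafPos k q → p < q →
      (π ⟨$⟩ʳ q) < (π ⟨$⟩ʳ p))
lemma2 k n k≥2 π avoids shrub = roots-decrease , leaves-decrease
  where
  k≥1 : 1 ≤ k
  k≥1 = ≤-trans (s≤s z≤n) k≥2
  roots-decrease : (p q : Fin (suc k * n)) → IsRootPos k p → IsRootPos k q → p < q →
    (π ⟨$⟩ʳ q) < (π ⟨$⟩ʳ p)
  roots-decrease p q _ q-root =
    earlier-above-ascent-bottom π avoids (root-is-ascent-bottom k n π k≥1 shrub q q-root)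
  leaves-decrease : (p q : Fin (suc k * n)) → IsLeafPos k p → IsLeafPos k q → p < q →
    (π ⟨$⟩ʳ q) < (π ⟨$⟩ʳ p)
  leaves-decrease p q p-leaf _ =
    later-below-ascent-top π avoids (leaf-is-ascent-top k n π shrub p p-leaf)
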